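{- Let $\alpha$ have its out-labels at positions $j_1<\dots<j_{k_\alpha}$. The map $f:\mathcal T_\alpha\to\mathcal{SE}_\alpha$, $f(T)=(S_T,E_T)$, is a bijection. Its inverse sends $(S,E)$ to the directed tree obtained by placing $E$ on $S$ and transferring labels: edges of $E$ labelled by an orientation receive that orientation, each edge of $E$ labelled $\leftrightarrow$ is subdivided by a new bivalent vertex with both resulting edges directed away from it, and all edges of $S$ not in $E$ are directed toward $E$.
   Context: $\alpha$ is a finite sequence of labels in $\{\mathrm{in},\mathrm{out}\}$ with $n_\alpha$ labels, $k_\alpha$ of them out. An $\alpha$-tree is a planar (plane-embedded) tree with directed edges and at least one interior (non-leaf) vertex, together with a chosen exterior vertex (leaf), such that: labelling each exterior vertex "in" if its incident edge is directed away from it and "out" if directed toward it, and reading exterior vertices in clockwise order from the chosen one, gives exactly $\alpha$; every interior vertex has at least one outgoing edge; and there is no bivalent vertex with one incoming and one outgoing edge. $\mathcal T_\alpha$ is the set of $\alpha$-trees. A Stasheff tree is a $(\mathrm{out},\mathrm{in},\dots,\mathrm{in})$-tree with at least two in-labels; equivalently a planar tree with a chosen exterior vertex (root) and no bivalent vertices, all edges directed toward the root. For $T\in\mathcal T_\alpha$: $S_T$ is the Stasheff tree obtained by forgetting orientations and deleting each bivalent vertex (merging its two edges), with the same chosen exterior vertex. The spine $P_T$ is the union, with orientations, of the shortest paths in $T$ between pairs of outgoing exterior vertices; its chosen exterior vertex is the first outgoing one. $E_T$ is obtained from $P_T$ by deleting vertices bivalent in $T$, merging their two edges into one edge labelled $\leftrightarrow$;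 other edges are labelled by their orientation in $T$. An essential spine is a planar tree $E$ with a chosen exterior vertex, each edge labelled by one of its two orientations or by $\leftrightarrow$, such that each external edge is labelled either with the orientation toward its exterior vertex or with $\leftrightarrow$, and each internal vertex has at least one outgoing edge (an edge labelled with the orientation pointing away from it). A Stasheff tree $S$ with $n_\alpha$ exterior vertices (numbered $1,\dots,n_\alpha$ clockwise from the root) and an essential spine $E$ are $(j_1,\dots,j_{k})$-compatible if the underlying planar tree of $E$ equals the subtree of $S$ formed by the union of shortest paths between the exterior vertices numbered $j_1,\dots,j_k$. $\mathcal{SE}_\alpha$ is the set of pairs $(S,E)$ with $S$ a Stasheff tree with $n_\alpha$ exterior vertices and $E$ an essential spine $(j_1,\dots,j_{k_\alpha})$-compatible with $S$, where $j_1,\dots,j_{k_\alpha}$ are the positions of the out-labels of $\alpha$. -}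

module Defs where

open import Data.Nat using (ℕ; zero; suc; _+_; _<ᵇ_; _≤_)
open import Data.Bool using (Bool; true; false; _∧_; if_then_else_)
open import Data.List using (List; []; _∷_; _++_; length; take; drop)
open import Data.List.Relation.Unary.All using (All)
open import Data.List.Relation.Unary.Any using (Any)
open import Data.Maybe using (Maybe; just; nothing)
open import Data.Product using (_×_)
open import Data.Sum using (_⊎_)
open import Data.Unit using (⊤)
open import Data.Empty using (⊥)
open import Relation.Binary.PropositionalEquality using (_≡_)
open import Relation.Nullary using (¬_)

-- A planar tree with a chosen exterior vertex (root leaf) is represented
-- by the rooted plane (ordered) tree hanging from the unique neighbour of
-- the root leaf: a node is a vertex different from the root leaf, its
-- list of children is in clockwise order (starting after the edge towards
-- the root), a node without children is an exterior vertex.  Every node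
-- carries the data of the edge joining it to its parent (for the top node,
-- the edge to the root leaf).  Exterior vertices read in depth-first order
-- are exactly the exterior vertices in clockwise order from the root.

-- labels of alpha ("in" is an Agda keyword, hence inn)
data Label : Set where
  inn out : Label

countOut : List Label → ℕ
countOut []         = 0
countOut (inn ∷ ls) = countOut ls
countOut (out ∷ ls) = suc (countOut ls)

-- orientation of the edge from a node to its parent:
-- up = directed towards the parent (towards the root leaf),
-- down = directed away from the parent.
data Dir : Set where
  up down : Dir

data DTree : Set where
  dnode : Dir → List DTree → DTree

dirOf : DTree → Dir
dirOf (dnode d _) = d

-- label of an exterior vertex (non-root): "in" iff its edge is directed away from it
leafLabel : Dir → Label
leafLabel up   = inn
leafLabel down = out

-- label of the root leaf: "in" iff the root edge is directed away from it
rootLabel : Dir → Label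
rootLabel up   = out
rootLabel down = inn

mutual
  leafLabels : DTree → List Label
  leafLabels (dnode d [])       = leafLabel d ∷ []
  leafLabels (dnode d (c ∷ cs)) = leafLabelsF (c ∷ cs)

  leafLabelsF : List DTree → List Label
  leafLabelsF []       = []
  leafLabelsF (c ∷ cs) = leafLabels c ++ leafLabelsF cs

labelsOf : DTree → List Label
labelsOf t = rootLabel (dirOf t) ∷ leafLabels t

HasOutgoing : Dir → List DTree → Set
HasOutgoing d cs = (d ≡ up) ⊎ Any (λ c → dirOf c ≡ down) cs

-- not a bivalent vertex with one incoming and one outgoing edge
NotTransit : Dir → List DTree → Set
NotTransit d (c ∷ []) = ¬ (dirOf c ≡ d)
NotTransit d _        = ⊤

mutual
  InteriorOK : DTree → Set
  InteriorOK (dnode d [])       = ⊤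
  InteriorOK (dnode d (c ∷ cs)) =
    HasOutgoing d (c ∷ cs) × NotTransit d (c ∷ cs) × InteriorOKF (c ∷ cs)

  InteriorOKF : List DTree → Set
  InteriorOKF []       = ⊤
  InteriorOKF (c ∷ cs) = InteriorOK c × InteriorOKF cs

-- at least one interior vertex: the neighbour of the root leaf is not a leaf
HasInterior : DTree → Set
HasInterior (dnode _ cs) = 1 ≤ length cs

IsAlphaTree : List Label → DTree → Set
IsAlphaTree α t = HasInterior t × InteriorOK t × labelsOf t ≡ α

data STree : Set where
  snode : List STree → STree

mutual
  NoBivalent : STree → Set
  NoBivalent (snode [])           = ⊤
  NoBivalent (snode (c ∷ []))     = ⊥
  NoBivalent (snode (c ∷ d ∷ cs)) = NoBivalentF (c ∷ d ∷ cs)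

  NoBivalentF : List STree → Set
  NoBivalentF []       = ⊤
  NoBivalentF (c ∷ cs) = NoBivalent c × NoBivalentF cs

-- a Stasheff tree: no bivalent vertices and at least two in-labels,
-- i.e. at least three exterior vertices (the top node has >= 2 children)
IsStasheff : STree → Set
IsStasheff s@(snode cs) = 2 ≤ length cs × NoBivalent s

mutual
  sLeaves : STree → ℕ
  sLeaves (snode [])       = 1
  sLeaves (snode (c ∷ cs)) = sLeavesF (c ∷ cs)

  sLeavesF : List STree → ℕ
  sLeavesF []       = 0
  sLeavesF (c ∷ cs) = sLeaves c + sLeavesF cs

-- number of exterior vertices (including the chosen one)
nExterior : STree → ℕ
nExterior s = suc (sLeaves s)

-- Each edge of S carries  nothing  (edge not in E)  or  just l  (edge in E
-- with label l).  Orientations are relative to the root of S: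
-- ⇑ = directed towards the parent, ⇓ = directed away from it, ⇕ = ↔.

data Lab : Set where
  ⇑ ⇓ ⇕ : Lab

data ETree : Set where
  enode : Maybe Lab → List ETree → ETree

labOf : ETree → Maybe Lab
labOf (enode m _) = m

mutual
  forget : ETree → STree
  forget (enode _ cs) = snode (forgetF cs)

  forgetF : List ETree → List STree
  forgetF []       = []
  forgetF (c ∷ cs) = forget c ∷ forgetF cs

mutual
  eLeaves : ETree → ℕ
  eLeaves (enode _ [])       = 1
  eLeaves (enode _ (c ∷ cs)) = eLeavesF (c ∷ cs)

  eLeavesF : List ETree → ℕ
  eLeavesF []       = 0
  eLeavesF (c ∷ cs) = eLeaves c + eLeavesF cs

isJustB : Maybe Lab → Bool
isJustB (just _) = true
isJustB nothing  = false

-- the edge above a vertex whose subtree contains o marked exterior vertices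
-- lies on a shortest path between two of the k marked exterior vertices
-- iff 0 < o < k
onSpine : ℕ → ℕ → Bool
onSpine k o = (0 <ᵇ o) ∧ (o <ᵇ k)

-- Compatibility: the edges carrying a label are exactly the edges of the
-- union of shortest paths between the exterior vertices whose positions
-- carry "out" in the label list.  ls = labels of the non-root exterior
-- vertices of the current subtree onwards (in clockwise order).
mutual
  CompatT : ℕ → ETree → List Label → Set
  CompatT k e@(enode m cs) ls =
    isJustB m ≡ onSpine k (countOut (take (eLeaves e) ls)) × CompatF k cs ls

  CompatF : ℕ → List ETree → List Label → Set
  CompatF k []       ls = ⊤
  CompatF k (c ∷ cs) ls = CompatT k c ls × CompatF k cs (drop (eLeaves c) ls)

-- (j_1,…,j_k)-compatibility, j's = positions of out in α (position 1 = root).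
-- The union of shortest paths between the marked exterior vertices must be
-- nonempty (k ≥ 1) for a (nonempty) planar tree E to equal it.
Compatible : List Label → ETree → Set
Compatible []      e = ⊥
Compatible (r ∷ ls) e = 1 ≤ countOut (r ∷ ls) × CompatT (countOut (r ∷ ls)) e ls

jcount : List ETree → ℕ
jcount []       = 0
jcount (c ∷ cs) with labOf c
... | just _  = suc (jcount cs)
... | nothing = jcount cs

eDegree : Maybe Lab → List ETree → ℕ
eDegree (just _) cs = suc (jcount cs)
eDegree nothing  cs = jcount cs

IncomingOrBoth : Maybe Lab → List ETree → Set
IncomingOrBoth m cs =
  (¬ (m ≡ just ⇑)) × All (λ c → ¬ (labOf c ≡ just ⇓)) cs

HasOutE : Maybe Lab → List ETree → Set
HasOutE m cs = (m ≡ just ⇑) ⊎ Any (λ c → labOf c ≡ just ⇓) cs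

-- condition at a vertex of S according to its degree in E:
-- degree 0: not a vertex of E; degree 1: exterior vertex of E, its
-- (external) edge is directed towards it or ↔; degree ≥ 2: internal vertex
-- of E, has an outgoing edge.
VertexCond : ℕ → Maybe Lab → List ETree → Set
VertexCond zero          m cs = ⊤
VertexCond (suc zero)    m cs = IncomingOrBoth m cs
VertexCond (suc (suc _)) m cs = HasOutE m cs

mutual
  EssNodes : ETree → Set
  EssNodes (enode m cs) = VertexCond (eDegree m cs) m cs × EssNodesF cs

  EssNodesF : List ETree → Set
  EssNodesF []       = ⊤
  EssNodesF (c ∷ cs) = EssNodes c × EssNodesF cs

-- the root leaf of S: if it belongs to E it is an exterior vertex of E,
-- and the root edge must be directed towards it (⇑) or ↔.
EssRoot : ETree → Set
EssRoot (enode m _) = ¬ (m ≡ just ⇓)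

IsEssentialSpine : ETree → Set
IsEssentialSpine e = EssRoot e × EssNodes e

IsSE : List Label → ETree → Set
IsSE α e =
  IsStasheff (forget e) × nExterior (forget e) ≡ length α ×
  Compatible α e × IsEssentialSpine e

mutual
  outsD : DTree → ℕ
  outsD (dnode up [])         = 0
  outsD (dnode down [])       = 1
  outsD (dnode d (c ∷ cs))    = outsDF (c ∷ cs)

  outsDF : List DTree → ℕ
  outsDF []       = 0
  outsDF (c ∷ cs) = outsD c + outsDF cs

totalOuts : DTree → ℕ
totalOuts t@(dnode up _)   = suc (outsD t)
totalOuts t@(dnode down _) = outsD t

-- The spine P_T, recorded as a marking of the edges of T
-- (true = the edge above the node lies in P_T).
data MTree : Set where
  mnode : Dir → Bool → List MTree → MTree

mutual
  markP : ℕ → DTree → MTree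
  markP k t@(dnode d cs) = mnode d (onSpine k (outsD t)) (markPF k cs)

  markPF : ℕ → List DTree → List MTree
  markPF k []       = []
  markPF k (c ∷ cs) = markP k c ∷ markPF k cs

spineT : DTree → MTree
spineT t = markP (totalOuts t) t

dirLab : Dir → Lab
dirLab up   = ⇑
dirLab down = ⇓

setTop : Maybe Lab → ETree → ETree
setTop m (enode _ cs) = enode m cs

-- Deleting the vertices bivalent in T (merging their two edges): this yields
-- S_T (forgetting labels); edges of P_T keep their orientation, a merged
-- pair of edges of P_T is labelled ↔, edges outside P_T are unlabelled.
mutual
  contractE : MTree → ETree
  contractE (mnode d b [])           = enode (if b then just (dirLab d) else nothing) []
  contractE (mnode d b (c ∷ []))     = setTop (if b then just ⇕ else nothing) (contractE c)
  contractE (mnode d b (c ∷ c' ∷ cs)) =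
    enode (if b then just (dirLab d) else nothing) (contractEF (c ∷ c' ∷ cs))

  contractEF : List MTree → List ETree
  contractEF []       = []
  contractEF (c ∷ cs) = contractE c ∷ contractEF cs

fMap : DTree → ETree
fMap t = contractE (spineT t)

S_ : DTree → STree
S_ t = forget (fMap t)

-- an edge not in E is directed towards E: downwards iff the subtree below
-- it contains a marked exterior vertex (o > 0)
place : Maybe Lab → ℕ → List DTree → DTree
place (just ⇑) o ch = dnode up ch
place (just ⇓) o ch = dnode down ch
place (just ⇕) o ch = dnode up (dnode down ch ∷ [])   -- new bivalent source
place nothing  o ch = dnode (if 0 <ᵇ o then down else up) ch

mutual
  gT : ETree → List Label → DTree
  gT e@(enode m cs) ls = place m (countOut (take (eLeaves e) ls)) (gF cs ls)

  gF : List ETree → List Label → List DTree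
  gF []       ls = []
  gF (c ∷ cs) ls = gT c ls ∷ gF cs (drop (eLeaves c) ls)

gMap : List Label → ETree → DTree
gMap []       e = gT e []
gMap (_ ∷ ls) e = gT e ls

-- With k the number of "out" labels, an edge lies on the spine exactly when the
-- subtree below it contains between 1 and k - 1 "out" exterior vertices, a count read
-- off α. In an α-tree every edge off the spine points toward the spine (following
-- outgoing edges always ends at an "out" exterior vertex) and the only bivalent
-- vertices are sources subdividing spine edges, so T is recovered from (S_T, E_T).
-- Conversely the essential-spine conditions give the α-tree axioms for g(S, E), the
-- key counting fact being that no vertex of S has spine degree 1.

module Submission where

open import Defs
open import Data.Nat using (ℕ; zero; suc; _+_; _<ᵇ_; _≤_; _<_; z≤n; s≤s)
open import Data.Nat.Properties
open import Data.Bool using (Bool; true; false; if_then_else_)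
open import Data.List using (List; []; _∷_; _++_; length; take; drop; map)
open import Data.Nat.ListAction using (sum)
open import Data.List.Properties using (++-assoc; ++-identityʳ; length-++; take-all; take-[])
open import Data.List.Relation.Unary.All as All using (All; []; _∷_)
open import Data.List.Relation.Unary.All.Properties using (map⁻; ¬Any⇒All¬)
open import Data.List.Relation.Unary.Any using (Any; here; there)
open import Data.Maybe using (just; nothing)
open import Data.Product using (_×_; _,_; proj₁; proj₂)
open import Data.Sum using (_⊎_; inj₁; inj₂)
open import Data.Unit using (tt)
open import Data.Empty using (⊥-elim)
open import Relation.Binary.PropositionalEquality
open import Relation.Nullary using (¬_; contradiction)
open import Relation.Nullary.Reflects using (ofʸ; ofⁿ)

data SpineView (k o : ℕ) : Bool → Set where
  no-outs  : o ≡ 0 → SpineView k o false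
  on-spine : 1 ≤ o → o < k → SpineView k o true
  all-outs : 1 ≤ o → k ≤ o → SpineView k o false

spineView : ∀ k o → SpineView k o (onSpine k o)
spineView k zero = no-outs refl
spineView k (suc o) with suc o <ᵇ k | <ᵇ-reflects-< (suc o) k
... | true  | ofʸ o<k = on-spine (s≤s z≤n) o<k
... | false | ofⁿ o≮k = all-outs (s≤s z≤n) (≮⇒≥ o≮k)

OffSpine : ℕ → ℕ → Set
OffSpine k o = o ≡ 0 ⊎ k ≤ o

onSpine-true : ∀ {k o} → 1 ≤ o → o < k → onSpine k o ≡ true
onSpine-true {k} {o} 1≤o o<k with onSpine k o | spineView k o
... | true  | on-spine _ _  = refl
... | false | no-outs refl  = contradiction 1≤o λ ()
... | false | all-outs _ k≤o = contradiction o<k (≤⇒≯ k≤o)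

onSpine-false : ∀ {k o} → OffSpine k o → onSpine k o ≡ false
onSpine-false {k} {o} off with onSpine k o | spineView k o | off
... | false | _              | _            = refl
... | true  | on-spine 1≤o _ | inj₁ refl    = contradiction 1≤o λ ()
... | true  | on-spine _ o<k | inj₂ k≤o     = contradiction o<k (≤⇒≯ k≤o)

onSpine-self : ∀ n → onSpine n n ≡ false
onSpine-self n = onSpine-false {n} {n} (inj₂ ≤-refl)

bit : Bool → ℕ
bit true  = 1
bit false = 0

spineCount : ℕ → List ℕ → ℕ
spineCount k []       = 0
spineCount k (o ∷ os) = bit (onSpine k o) + spineCount k os

spineDegree : ℕ → List ℕ → ℕ
spineDegree k os = spineCount k os + bit (onSpine k (sum os))

sum≡0⇒spineCount≡0 : ∀ k os → sum os ≡ 0 → spineCount k os ≡ 0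
sum≡0⇒spineCount≡0 k []           _  = refl
sum≡0⇒spineCount≡0 k (zero ∷ os)  eq = sum≡0⇒spineCount≡0 k os eq

spineCount≡0⇒offSpine : ∀ k os → spineCount k os ≡ 0 → OffSpine k (sum os)
spineCount≡0⇒offSpine k []       _  = inj₁ refl
spineCount≡0⇒offSpine k (o ∷ os) eq with onSpine k o | spineView k o
... | false | no-outs refl  = spineCount≡0⇒offSpine k os eq
... | false | all-outs _ k≤o = inj₂ (≤-trans k≤o (m≤m+n o (sum os)))

m+n≤o⇒o≰n : ∀ {x y k} → x + y ≤ k → 1 ≤ x → ¬ (k ≤ y)
m+n≤o⇒o≰n {x} {y} x+y≤k 1≤x k≤y = <-irrefl refl (≤-trans (+-mono-≤ 1≤x k≤y) x+y≤k)

spineCount≡1⇒onSpine : ∀ k os → sum os ≤ k → spineCount k os ≡ 1 → 1 ≤ sum os × sum os < k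
spineCount≡1⇒onSpine k (o ∷ os) ≤k eq with onSpine k o | spineView k o
... | false | no-outs refl = spineCount≡1⇒onSpine k os ≤k eq
... | false | all-outs _ k≤o =
  contradiction k≤o (m+n≤o⇒o≰n (subst (_≤ k) (+-comm o (sum os)) ≤k)
    (proj₁ (spineCount≡1⇒onSpine k os (≤-trans (m≤n+m (sum os) o) ≤k) eq)))
... | true | on-spine 1≤o o<k with spineCount≡0⇒offSpine k os (suc-injective eq)
...   | inj₁ rest≡0 rewrite rest≡0 | +-identityʳ o = 1≤o , o<k
...   | inj₂ k≤rest = contradiction k≤rest (m+n≤o⇒o≰n ≤k 1≤o)

spineDegree≢1 : ∀ k os → sum os ≤ k → spineDegree k os ≢ 1
spineDegree≢1 k os ≤k with spineCount k os in eq
... | zero rewrite onSpine-false (spineCount≡0⇒offSpine k os eq) = λ ()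
... | suc zero rewrite onSpine-true (proj₁ (spineCount≡1⇒onSpine k os ≤k eq))
                                    (proj₂ (spineCount≡1⇒onSpine k os ≤k eq)) = λ ()
... | suc (suc _) = λ ()

saturated⇒spineCount≡0 : ∀ k os → sum os ≤ k → Any (k ≤_) os → spineCount k os ≡ 0 × k ≤ sum os
saturated⇒spineCount≡0 k (o ∷ os) ≤k (here k≤o) =
  cong₂ _+_ (cong bit (onSpine-false (inj₂ k≤o))) (sum≡0⇒spineCount≡0 k os rest≡0) ,
  ≤-trans k≤o (m≤m+n o (sum os))
  where
  rest≡0 : sum os ≡ 0
  rest≡0 = n≤0⇒n≡0 (+-cancelˡ-≤ o (sum os) 0 (≤-trans ≤k (≤-trans k≤o (≤-reflexive (sym (+-identityʳ o))))))
saturated⇒spineCount≡0 k (zero  ∷ os) ≤k (there sat) = saturated⇒spineCount≡0 k os ≤k sat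
saturated⇒spineCount≡0 k (suc o ∷ os) ≤k (there sat) = contradiction
  (proj₂ (saturated⇒spineCount≡0 k os (≤-trans (m≤n+m (sum os) (suc o)) ≤k) sat))
  (m+n≤o⇒o≰n ≤k (s≤s z≤n))

2≤spineDegree⇒All< : ∀ k os → sum os ≤ k → 2 ≤ spineDegree k os → All (_< k) os
2≤spineDegree⇒All< k os ≤k 2≤deg = All.map ≰⇒> (¬Any⇒All¬ os unsaturated)
  where
  unsaturated : ¬ Any (k ≤_) os
  unsaturated sat with saturated⇒spineCount≡0 k os ≤k sat
  ... | count≡0 , k≤sum =
    contradiction (subst (2 ≤_) (cong₂ _+_ count≡0 (cong bit (onSpine-false (inj₂ k≤sum)))) 2≤deg) λ ()

2≤spineDegree⇒1≤sum : ∀ k os → 2 ≤ spineDegree k os → 1 ≤ sum os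
2≤spineDegree⇒1≤sum k os 2≤deg = n≢0⇒n>0 λ sum≡0 → contradiction
  (subst (2 ≤_) (cong₂ _+_ (sum≡0⇒spineCount≡0 k os sum≡0) (cong (λ o → bit (onSpine k o)) sum≡0)) 2≤deg)
  λ ()

1≤sum⇒Any : ∀ os → 1 ≤ sum os → Any (1 ≤_) os
1≤sum⇒Any (zero  ∷ os) 1≤sum = there (1≤sum⇒Any os 1≤sum)
1≤sum⇒Any (suc _ ∷ os) _     = here (s≤s z≤n)

countOut-++ : ∀ xs ys → countOut (xs ++ ys) ≡ countOut xs + countOut ys
countOut-++ []         ys = refl
countOut-++ (inn ∷ xs) ys = countOut-++ xs ys
countOut-++ (out ∷ xs) ys = cong suc (countOut-++ xs ys)

countOut-take≤ : ∀ n ls → countOut (take n ls) ≤ countOut ls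
countOut-take≤ zero    ls         = z≤n
countOut-take≤ (suc n) []         = z≤n
countOut-take≤ (suc n) (inn ∷ ls) = countOut-take≤ n ls
countOut-take≤ (suc n) (out ∷ ls) = s≤s (countOut-take≤ n ls)

countOut-drop≤ : ∀ n ls → countOut (drop n ls) ≤ countOut ls
countOut-drop≤ zero    ls         = ≤-refl
countOut-drop≤ (suc n) []         = z≤n
countOut-drop≤ (suc n) (inn ∷ ls) = countOut-drop≤ n ls
countOut-drop≤ (suc n) (out ∷ ls) = m≤n⇒m≤1+n (countOut-drop≤ n ls)

module _ {A : Set} where

  take-length-++ : ∀ (xs ys : List A) → take (length xs) (xs ++ ys) ≡ xs
  take-length-++ []       ys = refl
  take-length-++ (x ∷ xs) ys = cong (x ∷_) (take-length-++ xs ys)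

  drop-length-++ : ∀ (xs ys : List A) → drop (length xs) (xs ++ ys) ≡ ys
  drop-length-++ []       ys = refl
  drop-length-++ (x ∷ xs) ys = drop-length-++ xs ys

  take-+ : ∀ m n (xs : List A) → take (m + n) xs ≡ take m xs ++ take n (drop m xs)
  take-+ zero    n xs       = refl
  take-+ (suc m) n []       = sym (take-[] n)
  take-+ (suc m) n (x ∷ xs) = cong (x ∷_) (take-+ m n xs)

  length-drop-≥ : ∀ m n (xs : List A) → m + n ≤ length xs → n ≤ length (drop m xs)
  length-drop-≥ zero    n xs       le        = le
  length-drop-≥ (suc m) n (x ∷ xs) (s≤s le) = length-drop-≥ m n xs le

mutual
  countOut-leafLabels : ∀ t → countOut (leafLabels t) ≡ outsD t
  countOut-leafLabels (dnode up   [])       = refl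
  countOut-leafLabels (dnode down [])       = refl
  countOut-leafLabels (dnode up   (c ∷ cs)) = countOut-leafLabelsF (c ∷ cs)
  countOut-leafLabels (dnode down (c ∷ cs)) = countOut-leafLabelsF (c ∷ cs)

  countOut-leafLabelsF : ∀ cs → countOut (leafLabelsF cs) ≡ outsDF cs
  countOut-leafLabelsF []       = refl
  countOut-leafLabelsF (c ∷ cs) =
    trans (countOut-++ (leafLabels c) _) (cong₂ _+_ (countOut-leafLabels c) (countOut-leafLabelsF cs))

countOut-labelsOf : ∀ t → countOut (labelsOf t) ≡ totalOuts t
countOut-labelsOf t@(dnode up   _) = cong suc (countOut-leafLabels t)
countOut-labelsOf t@(dnode down _) = countOut-leafLabels t

outsD-node : ∀ d c cs → outsD (dnode d (c ∷ cs)) ≡ outsDF (c ∷ cs)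
outsD-node up   c cs = refl
outsD-node down c cs = refl

outsDF≡sum : ∀ cs → outsDF cs ≡ sum (map outsD cs)
outsDF≡sum []       = refl
outsDF≡sum (c ∷ cs) = cong (outsD c +_) (outsDF≡sum cs)

-- The only bivalent vertices of an α-tree are sources, and no two of them are adjacent.
data Shape : DTree → Set where
  leaf                 : ∀ d → Shape (dnode d [])
  branching            : ∀ d c c′ cs → Shape (dnode d (c ∷ c′ ∷ cs))
  subdivided-leaf      : Shape (dnode up (dnode down [] ∷ []))
  subdivided-branching : ∀ c c′ cs → Shape (dnode up (dnode down (c ∷ c′ ∷ cs) ∷ []))

shape : ∀ t → InteriorOK t → Shape t
shape (dnode d [])                                _ = leaf d
shape (dnode d (c ∷ c′ ∷ cs))                     _ = branching d c c′ cs
shape (dnode up   (dnode up   _ ∷ []))            (_ , transit , _) = ⊥-elim (transit refl)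
shape (dnode down (dnode down _ ∷ []))            (_ , transit , _) = ⊥-elim (transit refl)
shape (dnode down (dnode up _ ∷ []))              (inj₁ () , _)
shape (dnode down (dnode up _ ∷ []))              (inj₂ (here ()) , _)
shape (dnode down (dnode up _ ∷ []))              (inj₂ (there ()) , _)
shape (dnode up (dnode down [] ∷ []))             _ = subdivided-leaf
shape (dnode up (dnode down (c ∷ c′ ∷ cs) ∷ []))  _ = subdivided-branching c c′ cs
shape (dnode up (dnode down (c ∷ []) ∷ []))       (_ , _ , ok , _) with shape (dnode down (c ∷ [])) ok
... | ()

-- Following outgoing edges away from the root always ends at an "out" exterior vertex.
mutual
  down⇒1≤outsD : ∀ t → InteriorOK t → dirOf t ≡ down → 1 ≤ outsD t
  down⇒1≤outsD (dnode down [])       _                    refl = s≤s z≤n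
  down⇒1≤outsD (dnode down (c ∷ cs)) (inj₁ () , _)        refl
  down⇒1≤outsD (dnode down (c ∷ cs)) (inj₂ d , _ , okF)   refl = Any-down⇒1≤outsDF (c ∷ cs) okF d

  Any-down⇒1≤outsDF : ∀ cs → InteriorOKF cs → Any (λ c → dirOf c ≡ down) cs → 1 ≤ outsDF cs
  Any-down⇒1≤outsDF (c ∷ cs) (ok , _)  (here d)  = ≤-trans (down⇒1≤outsD c ok d) (m≤m+n _ _)
  Any-down⇒1≤outsDF (c ∷ cs) (_ , okF) (there d) = ≤-trans (Any-down⇒1≤outsDF cs okF d) (m≤n+m _ _)

-- With k the total number of "out" exterior vertices: an edge directed toward the
-- root leads to an "out" exterior vertex outside the subtree below it.
OutsBounded : ℕ → DTree → Set
OutsBounded k t = outsD t ≤ k × (dirOf t ≡ up → outsD t < k)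

outsBounded-root : ∀ t → OutsBounded (totalOuts t) t
outsBounded-root (dnode up   cs) = n≤1+n _ , λ _ → ≤-refl
outsBounded-root (dnode down cs) = ≤-refl , λ ()

outsD≤outsDF : ∀ cs → All (λ c → outsD c ≤ outsDF cs) cs
outsD≤outsDF []       = []
outsD≤outsDF (c ∷ cs) = m≤m+n _ _ ∷ All.map (λ le → ≤-trans le (m≤n+m _ (outsD c))) (outsD≤outsDF cs)

up-child<outsDF : ∀ cs → InteriorOKF cs → Any (λ c → dirOf c ≡ down) cs →
  All (λ c → dirOf c ≡ up → outsD c < outsDF cs) cs
up-child<outsDF (c ∷ cs) (ok , _) (here c-down) =
  (λ c-up → contradiction (trans (sym c-down) c-up) λ ()) ∷
  All.map (λ le _ → +-mono-≤ (down⇒1≤outsD c ok c-down) le) (outsD≤outsDF cs)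
up-child<outsDF (c ∷ cs) (_ , okF) (there d) =
  (λ _ → subst (_≤ outsD c + outsDF cs) (+-comm (outsD c) 1)
                (+-monoʳ-≤ (outsD c) (Any-down⇒1≤outsDF cs okF d))) ∷
  All.map (λ lt c-up → ≤-trans (lt c-up) (m≤n+m _ (outsD c))) (up-child<outsDF cs okF d)

children-outsBounded : ∀ k d c cs → InteriorOK (dnode d (c ∷ cs)) →
  OutsBounded k (dnode d (c ∷ cs)) → All (OutsBounded k) (c ∷ cs)
children-outsBounded k up c cs _ (≤k , <k) =
  All.map (λ le → ≤-trans le ≤k , λ _ → ≤-<-trans le (<k refl)) (outsD≤outsDF (c ∷ cs))
children-outsBounded k down c cs (inj₁ () , _)
children-outsBounded k down c cs (inj₂ d , _ , okF) (≤k , _) =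
  All.zipWith (λ (le , lt) → ≤-trans le ≤k , λ c-up → ≤-trans (lt c-up) ≤k)
    (outsD≤outsDF (c ∷ cs) , up-child<outsDF (c ∷ cs) okF d)

eLeaves-setTop : ∀ m e → eLeaves (setTop m e) ≡ eLeaves e
eLeaves-setTop m (enode _ [])       = refl
eLeaves-setTop m (enode _ (c ∷ cs)) = refl

forget-setTop : ∀ m e → forget (setTop m e) ≡ forget e
forget-setTop m (enode _ cs) = refl

labOf-setTop : ∀ m e → labOf (setTop m e) ≡ m
labOf-setTop m (enode _ cs) = refl

isJustB-if : ∀ b (l : Lab) → isJustB (if b then just l else nothing) ≡ b
isJustB-if true  l = refl
isJustB-if false l = refl

jcount-∷ : ∀ c cs → jcount (c ∷ cs) ≡ bit (isJustB (labOf c)) + jcount cs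
jcount-∷ c cs with labOf c
... | just _  = refl
... | nothing = refl

eDegree-bit : ∀ m cs → eDegree m cs ≡ jcount cs + bit (isJustB m)
eDegree-bit (just _) cs = +-comm 1 (jcount cs)
eDegree-bit nothing  cs = sym (+-identityʳ (jcount cs))

mutual
  sLeaves-forget : ∀ e → sLeaves (forget e) ≡ eLeaves e
  sLeaves-forget (enode m [])       = refl
  sLeaves-forget (enode m (c ∷ cs)) = sLeavesF-forgetF (c ∷ cs)

  sLeavesF-forgetF : ∀ cs → sLeavesF (forgetF cs) ≡ eLeavesF cs
  sLeavesF-forgetF []       = refl
  sLeavesF-forgetF (c ∷ cs) = cong₂ _+_ (sLeaves-forget c) (sLeavesF-forgetF cs)

module _ (k : ℕ) where

  contract : DTree → ETree
  contract t = contractE (markP k t)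

  contractF : List DTree → List ETree
  contractF cs = contractEF (markPF k cs)

  mutual
    eLeaves-contract : ∀ t → eLeaves (contract t) ≡ length (leafLabels t)
    eLeaves-contract (dnode d [])            = refl
    eLeaves-contract (dnode d (c ∷ []))      = begin
      eLeaves (setTop _ (contract c))  ≡⟨ eLeaves-setTop _ (contract c) ⟩
      eLeaves (contract c)             ≡⟨ eLeaves-contract c ⟩
      length (leafLabels c)            ≡⟨ cong length (++-identityʳ (leafLabels c)) ⟨
      length (leafLabels c ++ [])      ∎
      where open ≡-Reasoning
    eLeaves-contract (dnode d (c ∷ c′ ∷ cs)) = eLeavesF-contractF (c ∷ c′ ∷ cs)

    eLeavesF-contractF : ∀ cs → eLeavesF (contractF cs) ≡ length (leafLabelsF cs)
    eLeavesF-contractF []       = refl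
    eLeavesF-contractF (c ∷ cs) =
      trans (cong₂ _+_ (eLeaves-contract c) (eLeavesF-contractF cs)) (sym (length-++ (leafLabels c)))

  mutual
    noBivalent-contract : ∀ t → NoBivalent (forget (contract t))
    noBivalent-contract (dnode d [])            = tt
    noBivalent-contract (dnode d (c ∷ []))      =
      subst NoBivalent (sym (forget-setTop _ (contract c))) (noBivalent-contract c)
    noBivalent-contract (dnode d (c ∷ c′ ∷ cs)) = noBivalentF-contractF (c ∷ c′ ∷ cs)

    noBivalentF-contractF : ∀ cs → NoBivalentF (forgetF (contractF cs))
    noBivalentF-contractF []       = tt
    noBivalentF-contractF (c ∷ cs) = noBivalent-contract c , noBivalentF-contractF cs

  isJust-contract : ∀ t → isJustB (labOf (contract t)) ≡ onSpine k (outsD t)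
  isJust-contract (dnode d [])            = isJustB-if _ _
  isJust-contract (dnode d (c ∷ []))      =
    trans (cong isJustB (labOf-setTop _ (contract c))) (isJustB-if _ _)
  isJust-contract (dnode d (c ∷ c′ ∷ cs)) = isJustB-if _ _

  jcount-contractF : ∀ cs → jcount (contractF cs) ≡ spineCount k (map outsD cs)
  jcount-contractF []       = refl
  jcount-contractF (c ∷ cs) = trans (jcount-∷ (contract c) _)
    (cong₂ _+_ (cong bit (isJust-contract c)) (jcount-contractF cs))

  countOut-take-contract : ∀ t rest → countOut (take (eLeaves (contract t)) (leafLabels t ++ rest)) ≡ outsD t
  countOut-take-contract t rest
    rewrite eLeaves-contract t | take-length-++ (leafLabels t) rest = countOut-leafLabels t

  drop-contract : ∀ t rest → drop (eLeaves (contract t)) (leafLabels t ++ rest) ≡ rest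
  drop-contract t rest rewrite eLeaves-contract t = drop-length-++ (leafLabels t) rest

  compat-top : ∀ t rest →
    isJustB (labOf (contract t)) ≡ onSpine k (countOut (take (eLeaves (contract t)) (leafLabels t ++ rest)))
  compat-top t rest = trans (isJust-contract t) (cong (onSpine k) (sym (countOut-take-contract t rest)))

  setTop-compat : ∀ m e ls → CompatT k e ls →
    isJustB (labOf (setTop m e)) ≡ onSpine k (countOut (take (eLeaves (setTop m e)) ls)) →
    CompatT k (setTop m e) ls
  setTop-compat m (enode _ [])       ls (_ , compatF) top = top , compatF
  setTop-compat m (enode _ (c ∷ cs)) ls (_ , compatF) top = top , compatF

  mutual
    compat-contract : ∀ t rest → CompatT k (contract t) (leafLabels t ++ rest)
    compat-contract (dnode d [])            rest = compat-top (dnode d []) rest , tt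
    compat-contract (dnode d (c ∷ []))      rest =
      setTop-compat _ (contract c) _
        (subst (CompatT k (contract c)) (cong (_++ rest) (sym (++-identityʳ (leafLabels c))))
               (compat-contract c rest))
        (compat-top (dnode d (c ∷ [])) rest)
    compat-contract (dnode d (c ∷ c′ ∷ cs)) rest =
      compat-top (dnode d (c ∷ c′ ∷ cs)) rest , compatF-contractF (c ∷ c′ ∷ cs) rest

    compatF-contractF : ∀ cs rest → CompatF k (contractF cs) (leafLabelsF cs ++ rest)
    compatF-contractF []       rest = tt
    compatF-contractF (c ∷ cs) rest
      rewrite ++-assoc (leafLabels c) (leafLabelsF cs) rest
            | drop-contract c (leafLabelsF cs ++ rest)
      = compat-contract c (leafLabelsF cs ++ rest) , compatF-contractF cs rest

vertexCond-≥2 : ∀ m chs → eDegree m chs ≢ 1 → (2 ≤ eDegree m chs → HasOutE m chs) →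
  VertexCond (eDegree m chs) m chs
vertexCond-≥2 m chs ≢1 hasOut with eDegree m chs
... | zero        = tt
... | suc zero    = contradiction refl ≢1
... | suc (suc _) = hasOut (s≤s (s≤s z≤n))

on-spine-up-label : ∀ d b → d ≡ up → b ≡ true → (if b then just (dirLab d) else nothing) ≡ just ⇑
on-spine-up-label .up .true refl refl = refl

module _ (k : ℕ) where

  down-child-label : ∀ c → InteriorOK c → dirOf c ≡ down → outsD c < k → labOf (contract k c) ≡ just ⇓
  down-child-label (dnode down [])                _  refl <k
    rewrite onSpine-true {k} {1} (s≤s z≤n) <k = refl
  down-child-label (dnode down (c ∷ []))          ok refl _ with shape _ ok
  ... | ()
  down-child-label t@(dnode down (c ∷ c′ ∷ cs))   ok refl <k
    rewrite onSpine-true {k} {outsD t} (down⇒1≤outsD t ok refl) <k = refl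

  Any-down-contract : ∀ cs → InteriorOKF cs → All (λ c → outsD c < k) cs →
    Any (λ c → dirOf c ≡ down) cs → Any (λ e → labOf e ≡ just ⇓) (contractF k cs)
  Any-down-contract (c ∷ cs) (ok , _)  (<k ∷ _)   (here c-down) = here (down-child-label c ok c-down <k)
  Any-down-contract (c ∷ cs) (_ , okF) (_ ∷ <ks) (there d)      = there (Any-down-contract cs okF <ks d)

  subdivided-bounded : ∀ cs → OutsBounded k (dnode up (dnode down cs ∷ [])) → OutsBounded k (dnode down cs)
  subdivided-bounded cs (≤k , _) = subst (_≤ k) (+-identityʳ _) ≤k , λ ()

  subdivided-onSpine : ∀ cs → InteriorOK (dnode down cs) → OutsBounded k (dnode up (dnode down cs ∷ [])) →
    onSpine k (outsD (dnode down cs)) ≡ true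
  subdivided-onSpine cs ok (_ , up⇒<k) =
    onSpine-true (down⇒1≤outsD _ ok refl) (subst (_< k) (+-identityʳ _) (up⇒<k refl))

  subdivided-onSpine′ : ∀ cs → InteriorOK (dnode down cs) → OutsBounded k (dnode up (dnode down cs ∷ [])) →
    onSpine k (outsD (dnode up (dnode down cs ∷ []))) ≡ true
  subdivided-onSpine′ cs ok bounded =
    subst (λ o → onSpine k o ≡ true) (sym (+-identityʳ _)) (subdivided-onSpine cs ok bounded)

  -- A branching vertex never has spine degree 1; if the spine passes through it,
  -- an outgoing edge of T at it is also an outgoing edge of E_T.
  branching-vertexCond : ∀ d c c′ cs m → InteriorOK (dnode d (c ∷ c′ ∷ cs)) →
    OutsBounded k (dnode d (c ∷ c′ ∷ cs)) →
    isJustB m ≡ onSpine k (outsD (dnode d (c ∷ c′ ∷ cs))) →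
    (d ≡ up → onSpine k (outsD (dnode d (c ∷ c′ ∷ cs))) ≡ true → m ≡ just ⇑) →
    VertexCond (eDegree m (contractF k (c ∷ c′ ∷ cs))) m (contractF k (c ∷ c′ ∷ cs))
  branching-vertexCond d c c′ cs m ok (≤k , up⇒<k) top up⇒⇑ =
    vertexCond-≥2 m chs (λ deg≡1 → spineDegree≢1 k os sum≤k (trans (sym deg≡) deg≡1)) hasOut
    where
    chs : List ETree
    chs = contractF k (c ∷ c′ ∷ cs)
    os : List ℕ
    os = map outsD (c ∷ c′ ∷ cs)
    outs≡sum : outsD (dnode d (c ∷ c′ ∷ cs)) ≡ sum os
    outs≡sum = trans (outsD-node d c (c′ ∷ cs)) (outsDF≡sum (c ∷ c′ ∷ cs))
    sum≤k : sum os ≤ k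
    sum≤k = subst (_≤ k) outs≡sum ≤k
    deg≡ : eDegree m chs ≡ spineDegree k os
    deg≡ = trans (eDegree-bit m chs)
      (cong₂ _+_ (jcount-contractF k (c ∷ c′ ∷ cs)) (cong bit (trans top (cong (onSpine k) outs≡sum))))
    hasOut : 2 ≤ eDegree m chs → HasOutE m chs
    hasOut 2≤ with proj₁ ok
    ... | inj₁ d≡up = inj₁ (up⇒⇑ d≡up (onSpine-true
            (subst (1 ≤_) (sym outs≡sum) (2≤spineDegree⇒1≤sum k os (subst (2 ≤_) deg≡ 2≤)))
            (up⇒<k d≡up)))
    ... | inj₂ down-child = inj₂ (Any-down-contract (c ∷ c′ ∷ cs) (proj₂ (proj₂ ok))
            (map⁻ (2≤spineDegree⇒All< k os sum≤k (subst (2 ≤_) deg≡ 2≤))) down-child)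

  mutual
    essential-contract : ∀ t → InteriorOK t → OutsBounded k t → EssNodes (contract k t)
    essential-contract t ok bounded with shape t ok
    ... | leaf up   = tt , tt
    ... | subdivided-leaf rewrite onSpine-true {k} {1} (s≤s z≤n) (proj₂ bounded refl) = ((λ ()) , []) , tt
    ... | subdivided-branching c c′ cs =
      subst (λ b → EssNodes (setTop (if b then just ⇕ else nothing) (contract k child)))
            (sym (subdivided-onSpine′ (c ∷ c′ ∷ cs) child-ok bounded))
            (branching-vertexCond down c c′ cs (just ⇕) child-ok child-bounded
               (sym (subdivided-onSpine (c ∷ c′ ∷ cs) child-ok bounded)) (λ ()) ,
             essentialF-contractF (c ∷ c′ ∷ cs) (proj₂ (proj₂ child-ok))
               (children-outsBounded k down c (c′ ∷ cs) child-ok child-bounded))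
      where
      child : DTree
      child = dnode down (c ∷ c′ ∷ cs)
      child-ok : InteriorOK child
      child-ok = proj₁ (proj₂ (proj₂ ok))
      child-bounded : OutsBounded k child
      child-bounded = subdivided-bounded (c ∷ c′ ∷ cs) bounded
    ... | branching d c c′ cs =
      branching-vertexCond d c c′ cs _ ok bounded (isJustB-if _ _) (on-spine-up-label d _) ,
      essentialF-contractF (c ∷ c′ ∷ cs) (proj₂ (proj₂ ok)) (children-outsBounded k d c (c′ ∷ cs) ok bounded)
    ... | leaf down with onSpine k 1
    ...   | true  = ((λ ()) , []) , tt
    ...   | false = tt , tt

    essentialF-contractF : ∀ cs → InteriorOKF cs → All (OutsBounded k) cs → EssNodesF (contractF k cs)
    essentialF-contractF []       _           _                 = tt
    essentialF-contractF (c ∷ cs) (ok , okF) (bounded ∷ boundeds) =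
      essential-contract c ok bounded , essentialF-contractF cs okF boundeds

childOuts : List ETree → List Label → List ℕ
childOuts []       ls = []
childOuts (c ∷ cs) ls = countOut (take (eLeaves c) ls) ∷ childOuts cs (drop (eLeaves c) ls)

sum-childOuts : ∀ cs ls → sum (childOuts cs ls) ≡ countOut (take (eLeavesF cs) ls)
sum-childOuts []       ls = refl
sum-childOuts (c ∷ cs) ls = begin
  countOut (take (eLeaves c) ls) + sum (childOuts cs (drop (eLeaves c) ls))
    ≡⟨ cong (countOut (take (eLeaves c) ls) +_) (sum-childOuts cs (drop (eLeaves c) ls)) ⟩
  countOut (take (eLeaves c) ls) + countOut (take (eLeavesF cs) (drop (eLeaves c) ls))
    ≡⟨ countOut-++ (take (eLeaves c) ls) _ ⟨
  countOut (take (eLeaves c) ls ++ take (eLeavesF cs) (drop (eLeaves c) ls))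
    ≡⟨ cong countOut (take-+ (eLeaves c) _ ls) ⟨
  countOut (take (eLeaves c + eLeavesF cs) ls) ∎
  where open ≡-Reasoning

eDegree≡0 : ∀ m cs → eDegree m cs ≡ 0 → m ≡ nothing × All (λ c → labOf c ≡ nothing) cs
eDegree≡0 nothing cs deg≡0 = refl , unlabelled cs deg≡0
  where
  unlabelled : ∀ cs → jcount cs ≡ 0 → All (λ c → labOf c ≡ nothing) cs
  unlabelled []                         _  = []
  unlabelled (enode nothing  _ ∷ cs) eq = refl ∷ unlabelled cs eq

place-nothing-pos : ∀ o ch → 1 ≤ o → dirOf (place nothing o ch) ≡ down
place-nothing-pos (suc o) ch _ = refl

Any-pos-g : ∀ cs ls → All (λ c → labOf c ≡ nothing) cs → Any (1 ≤_) (childOuts cs ls) →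
  Any (λ g → dirOf g ≡ down) (gF cs ls)
Any-pos-g (enode nothing cs′ ∷ cs) ls (refl ∷ _) (here 1≤o) = here (place-nothing-pos _ (gF cs′ ls) 1≤o)
Any-pos-g (c ∷ cs) ls (_ ∷ unlabelled) (there pos) = there (Any-pos-g cs (drop (eLeaves c) ls) unlabelled pos)

Any-⇓-g : ∀ cs ls → Any (λ c → labOf c ≡ just ⇓) cs → Any (λ g → dirOf g ≡ down) (gF cs ls)
Any-⇓-g (enode (just ⇓) _ ∷ cs) ls (here refl) = here refl
Any-⇓-g (c ∷ cs)                ls (there p)   = there (Any-⇓-g cs (drop (eLeaves c) ls) p)

hasOutgoing-place-nothing : ∀ o ch → (1 ≤ o → Any (λ g → dirOf g ≡ down) ch) →
  HasOutgoing (dirOf (place nothing o ch)) ch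
hasOutgoing-place-nothing zero    ch _     = inj₁ refl
hasOutgoing-place-nothing (suc o) ch below = inj₂ (below (s≤s z≤n))

leafLabels-place : ∀ m o g gs → leafLabels (place m o (g ∷ gs)) ≡ leafLabelsF (g ∷ gs)
leafLabels-place (just ⇑) o g gs = refl
leafLabels-place (just ⇓) o g gs = refl
leafLabels-place (just ⇕) o g gs = ++-identityʳ _
leafLabels-place nothing  o g gs = refl

hasInterior-place : ∀ m o g gs → HasInterior (place m o (g ∷ gs))
hasInterior-place (just ⇑) o g gs = s≤s z≤n
hasInterior-place (just ⇓) o g gs = s≤s z≤n
hasInterior-place (just ⇕) o g gs = s≤s z≤n
hasInterior-place nothing  o g gs = s≤s z≤n

module _ (k : ℕ) where

  jcount-childOuts : ∀ cs ls → CompatF k cs ls → jcount cs ≡ spineCount k (childOuts cs ls)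
  jcount-childOuts []       ls _                     = refl
  jcount-childOuts (c@(enode _ _) ∷ cs) ls ((top , _) , compatF) =
    trans (jcount-∷ c cs) (cong₂ _+_ (cong bit top) (jcount-childOuts cs _ compatF))

  eDegree-compat : ∀ m c cs ls → CompatT k (enode m (c ∷ cs)) ls →
    eDegree m (c ∷ cs) ≡ spineDegree k (childOuts (c ∷ cs) ls)
  eDegree-compat m c cs ls (top , compatF) = trans (eDegree-bit m (c ∷ cs))
    (cong₂ _+_ (jcount-childOuts (c ∷ cs) ls compatF)
               (cong bit (trans top (cong (onSpine k) (sym (sum-childOuts (c ∷ cs) ls))))))

  -- Either no edge of E meets the vertex, and then the edges of S point toward the
  -- marked exterior vertices below it, or (spine degree 1 being impossible) E has an
  -- outgoing edge there, which is not the parent edge.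
  Any-down-g : ∀ m c cs ls → VertexCond (eDegree m (c ∷ cs)) m (c ∷ cs) → CompatT k (enode m (c ∷ cs)) ls →
    countOut ls ≤ k → m ≢ just ⇑ → (m ≡ nothing → 1 ≤ countOut (take (eLeavesF (c ∷ cs)) ls)) →
    Any (λ g → dirOf g ≡ down) (gF (c ∷ cs) ls)
  Any-down-g m c cs ls vc compat ≤k ≢⇑ marked with eDegree m (c ∷ cs) in deg | vc
  ... | suc zero    | _          = contradiction (trans (sym (eDegree-compat m c cs ls compat)) deg)
    (spineDegree≢1 k (childOuts (c ∷ cs) ls)
      (subst (_≤ k) (sym (sum-childOuts (c ∷ cs) ls)) (≤-trans (countOut-take≤ (eLeavesF (c ∷ cs)) ls) ≤k)))
  ... | suc (suc _) | inj₁ m≡⇑   = contradiction m≡⇑ ≢⇑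
  ... | suc (suc _) | inj₂ child⇓ = Any-⇓-g (c ∷ cs) ls child⇓
  ... | zero        | _ with eDegree≡0 m (c ∷ cs) deg
  ...   | refl , unlabelled = Any-pos-g (c ∷ cs) ls unlabelled (1≤sum⇒Any (childOuts (c ∷ cs) ls)
            (subst (1 ≤_) (sym (sum-childOuts (c ∷ cs) ls)) (marked refl)))

  mutual
    interiorOK-g : ∀ e ls → EssNodes e → CompatT k e ls → countOut ls ≤ k → NoBivalent (forget e) →
      InteriorOK (gT e ls)
    interiorOK-g (enode (just ⇑) [])        ls _ _ _ _ = tt
    interiorOK-g (enode (just ⇓) [])        ls _ _ _ _ = tt
    interiorOK-g (enode (just ⇕) [])        ls _ _ _ _ = inj₁ refl , (λ ()) , (tt , tt)
    interiorOK-g (enode nothing  [])        ls _ _ _ _ = tt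
    interiorOK-g (enode m (c ∷ []))         ls _ _ _ ()
    interiorOK-g (enode (just ⇑) (c ∷ c′ ∷ cs)) ls (_ , essF) (_ , compatF) ≤k noBiv =
      inj₁ refl , tt , interiorOKF-g (c ∷ c′ ∷ cs) ls essF compatF ≤k noBiv
    interiorOK-g (enode (just ⇓) (c ∷ c′ ∷ cs)) ls (vc , essF) compat ≤k noBiv =
      inj₂ (Any-down-g (just ⇓) c (c′ ∷ cs) ls vc compat ≤k (λ ()) (λ ())) , tt ,
      interiorOKF-g (c ∷ c′ ∷ cs) ls essF (proj₂ compat) ≤k noBiv
    interiorOK-g (enode (just ⇕) (c ∷ c′ ∷ cs)) ls (vc , essF) compat ≤k noBiv =
      inj₁ refl , (λ ()) ,
      ((inj₂ (Any-down-g (just ⇕) c (c′ ∷ cs) ls vc compat ≤k (λ ()) (λ ())) , tt ,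
        interiorOKF-g (c ∷ c′ ∷ cs) ls essF (proj₂ compat) ≤k noBiv) , tt)
    interiorOK-g (enode nothing (c ∷ c′ ∷ cs)) ls (vc , essF) compat ≤k noBiv =
      hasOutgoing-place-nothing _ _
        (λ pos → Any-down-g nothing c (c′ ∷ cs) ls vc compat ≤k (λ ()) (λ _ → pos)) , tt ,
      interiorOKF-g (c ∷ c′ ∷ cs) ls essF (proj₂ compat) ≤k noBiv

    interiorOKF-g : ∀ cs ls → EssNodesF cs → CompatF k cs ls → countOut ls ≤ k → NoBivalentF (forgetF cs) →
      InteriorOKF (gF cs ls)
    interiorOKF-g []       ls _ _ _ _ = tt
    interiorOKF-g (c ∷ cs) ls (ess , essF) (compat , compatF) ≤k (noBiv , noBivF) =
      interiorOK-g c ls ess compat ≤k noBiv ,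
      interiorOKF-g cs (drop (eLeaves c) ls) essF compatF (≤-trans (countOut-drop≤ (eLeaves c) ls) ≤k) noBivF

  mutual
    leafLabels-g : ∀ e ls → EssNodes e → CompatT k e ls → eLeaves e ≤ length ls → NoBivalent (forget e) →
      leafLabels (gT e ls) ≡ take (eLeaves e) ls
    leafLabels-g (enode (just ⇑) [])  ls         ((not⇑ , _) , _) _ _ _ = contradiction refl not⇑
    leafLabels-g (enode (just ⇓) [])  (inn ∷ ls) _ (() , _) _ _
    leafLabels-g (enode (just ⇓) [])  (out ∷ ls) _ _ _ _ = refl
    leafLabels-g (enode (just ⇕) [])  (inn ∷ ls) _ (() , _) _ _
    leafLabels-g (enode (just ⇕) [])  (out ∷ ls) _ _ _ _ = refl
    leafLabels-g (enode nothing [])   (inn ∷ ls) _ _ _ _ = refl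
    leafLabels-g (enode nothing [])   (out ∷ ls) _ _ _ _ = refl
    leafLabels-g (enode m [])         []         _ _ () _
    leafLabels-g (enode m (c ∷ []))   ls         _ _ _ ()
    leafLabels-g (enode m (c ∷ c′ ∷ cs)) ls (_ , essF) (_ , compatF) le noBiv =
      trans (leafLabels-place m _ _ _) (leafLabelsF-g (c ∷ c′ ∷ cs) ls essF compatF le noBiv)

    leafLabelsF-g : ∀ cs ls → EssNodesF cs → CompatF k cs ls → eLeavesF cs ≤ length ls →
      NoBivalentF (forgetF cs) → leafLabelsF (gF cs ls) ≡ take (eLeavesF cs) ls
    leafLabelsF-g []       ls _ _ _ _ = refl
    leafLabelsF-g (c ∷ cs) ls (ess , essF) (compat , compatF) le (noBiv , noBivF) =
      trans (cong₂ _++_ (leafLabels-g c ls ess compat (≤-trans (m≤m+n _ _) le) noBiv)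
                        (leafLabelsF-g cs (drop (eLeaves c) ls) essF compatF
                           (length-drop-≥ (eLeaves c) _ ls le) noBivF))
            (sym (take-+ (eLeaves c) _ ls))

  onSpine-g : ∀ e ls → EssNodes e → CompatT k e ls → eLeaves e ≤ length ls → NoBivalent (forget e) →
    onSpine k (outsD (gT e ls)) ≡ isJustB (labOf e)
  onSpine-g e@(enode _ _) ls ess compat le noBiv = begin
    onSpine k (outsD (gT e ls))                          ≡⟨ cong (onSpine k) (countOut-leafLabels (gT e ls)) ⟨
    onSpine k (countOut (leafLabels (gT e ls)))          ≡⟨ cong (λ xs → onSpine k (countOut xs))
                                                                 (leafLabels-g e ls ess compat le noBiv) ⟩
    onSpine k (countOut (take (eLeaves e) ls))           ≡⟨ proj₁ compat ⟨
    isJustB (labOf e)                                    ∎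
    where open ≡-Reasoning

  contract-place-leaf : ∀ m o → onSpine k (outsD (place m o [])) ≡ isJustB m →
    contract k (place m o []) ≡ enode m []
  contract-place-leaf (just ⇑) o spine = cong (λ b → enode (if b then just ⇑ else nothing) []) spine
  contract-place-leaf (just ⇓) o spine = cong (λ b → enode (if b then just ⇓ else nothing) []) spine
  contract-place-leaf (just ⇕) o spine = cong (λ b → enode (if b then just ⇕ else nothing) []) spine
  contract-place-leaf nothing  o spine =
    cong (λ b → enode (if b then just (dirLab (dirOf (place nothing o []))) else nothing) []) spine

  contract-place-branching : ∀ m o g g′ gs → onSpine k (outsD (place m o (g ∷ g′ ∷ gs))) ≡ isJustB m →
    contract k (place m o (g ∷ g′ ∷ gs)) ≡ enode m (contractF k (g ∷ g′ ∷ gs))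
  contract-place-branching (just ⇑) o g g′ gs spine =
    cong (λ b → enode (if b then just ⇑ else nothing) (contractF k (g ∷ g′ ∷ gs))) spine
  contract-place-branching (just ⇓) o g g′ gs spine =
    cong (λ b → enode (if b then just ⇓ else nothing) (contractF k (g ∷ g′ ∷ gs))) spine
  contract-place-branching (just ⇕) o g g′ gs spine =
    cong (λ b → enode (if b then just ⇕ else nothing) (contractF k (g ∷ g′ ∷ gs))) spine
  contract-place-branching nothing  o g g′ gs spine =
    cong (λ b → enode (if b then just (dirLab (dirOf (place nothing o (g ∷ g′ ∷ gs)))) else nothing)
                      (contractF k (g ∷ g′ ∷ gs))) spine

  mutual
    contract-g : ∀ e ls → EssNodes e → CompatT k e ls → eLeaves e ≤ length ls → NoBivalent (forget e) →
      contract k (gT e ls) ≡ e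
    contract-g e@(enode m []) ls ess compat le noBiv =
      contract-place-leaf m _ (onSpine-g e ls ess compat le noBiv)
    contract-g (enode m (c ∷ [])) ls _ _ _ ()
    contract-g e@(enode m (c ∷ c′ ∷ cs)) ls ess compat le noBiv =
      trans (contract-place-branching m _ _ _ _ (onSpine-g e ls ess compat le noBiv))
            (cong (enode m) (contractF-g (c ∷ c′ ∷ cs) ls (proj₂ ess) (proj₂ compat) le noBiv))

    contractF-g : ∀ cs ls → EssNodesF cs → CompatF k cs ls → eLeavesF cs ≤ length ls →
      NoBivalentF (forgetF cs) → contractF k (gF cs ls) ≡ cs
    contractF-g []       ls _ _ _ _ = refl
    contractF-g (c ∷ cs) ls (ess , essF) (compat , compatF) le (noBiv , noBivF) =
      cong₂ _∷_ (contract-g c ls ess compat (≤-trans (m≤m+n _ _) le) noBiv)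
                (contractF-g cs (drop (eLeaves c) ls) essF compatF (length-drop-≥ (eLeaves c) _ ls le) noBivF)

place-⇕ : ∀ b o ch → b ≡ true → place (if b then just ⇕ else nothing) o ch ≡ dnode up (dnode down ch ∷ [])
place-⇕ .true o ch refl = refl

module _ (k : ℕ) where

  place-contract : ∀ d o ch → (d ≡ up → o < k) → (d ≡ down → 1 ≤ o) →
    place (if onSpine k o then just (dirLab d) else nothing) o ch ≡ dnode d ch
  place-contract d o ch up⇒<k down⇒pos with onSpine k o | spineView k o
  place-contract up   o       ch _      _       | true  | on-spine _ _  = refl
  place-contract down o       ch _      _       | true  | on-spine _ _  = refl
  place-contract up   .0      ch _      _       | false | no-outs refl  = refl
  place-contract down .0      ch _      down⇒pos | false | no-outs refl = contradiction (down⇒pos refl) λ ()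
  place-contract up   o       ch up⇒<k  _       | false | all-outs _ k≤o = contradiction (up⇒<k refl) (≤⇒≯ k≤o)
  place-contract down (suc o) ch _      _       | false | all-outs _ _  = refl

  mutual
    g-contract : ∀ t rest → InteriorOK t → OutsBounded k t → gT (contract k t) (leafLabels t ++ rest) ≡ t
    g-contract t rest ok bounded with shape t ok
    ... | leaf up         = refl
    ... | subdivided-leaf = place-⇕ _ _ [] (onSpine-true (s≤s z≤n) (proj₂ bounded refl))
    ... | subdivided-branching c c′ cs =
      trans (place-⇕ _ _ _ (subdivided-onSpine′ k (c ∷ c′ ∷ cs) child-ok bounded))
            (cong (λ ch → dnode up (dnode down ch ∷ []))
              (trans (cong (λ ls → gF (contractF k (c ∷ c′ ∷ cs)) (ls ++ rest)) (++-identityʳ _))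
                     (gF-contractF (c ∷ c′ ∷ cs) rest (proj₂ (proj₂ child-ok))
                        (children-outsBounded k down c (c′ ∷ cs) child-ok
                          (subdivided-bounded k (c ∷ c′ ∷ cs) bounded)))))
      where
      child-ok : InteriorOK (dnode down (c ∷ c′ ∷ cs))
      child-ok = proj₁ (proj₂ (proj₂ ok))
    ... | branching d c c′ cs =
      trans (cong₂ (place (if onSpine k (outsD node) then just (dirLab d) else nothing))
                   (countOut-take-contract k node rest)
                   (gF-contractF (c ∷ c′ ∷ cs) rest (proj₂ (proj₂ ok))
                      (children-outsBounded k d c (c′ ∷ cs) ok bounded)))
            (place-contract d (outsD node) (c ∷ c′ ∷ cs) (proj₂ bounded) (down⇒1≤outsD node ok))
      where
      node : DTree
      node = dnode d (c ∷ c′ ∷ cs)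
    ... | leaf down with onSpine k 1
    ...   | true  = refl
    ...   | false = refl

    gF-contractF : ∀ cs rest → InteriorOKF cs → All (OutsBounded k) cs →
      gF (contractF k cs) (leafLabelsF cs ++ rest) ≡ cs
    gF-contractF []       rest _          _                    = refl
    gF-contractF (c ∷ cs) rest (ok , okF) (bounded ∷ boundeds) = cong₂ _∷_
      (trans (cong (gT (contract k c)) (++-assoc (leafLabels c) (leafLabelsF cs) rest))
             (g-contract c (leafLabelsF cs ++ rest) ok bounded))
      (trans (cong (λ ls → gF (contractF k cs) (drop (eLeaves (contract k c)) ls))
                   (++-assoc (leafLabels c) (leafLabelsF cs) rest))
        (trans (cong (gF (contractF k cs)) (drop-contract k c (leafLabelsF cs ++ rest)))
               (gF-contractF cs rest okF boundeds)))

label-≢⇓ : ∀ b l → l ≢ ⇓ → (if b then just l else nothing) ≢ just ⇓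
label-≢⇓ true  l l≢⇓ refl = l≢⇓ refl
label-≢⇓ false l _   ()

stasheff-fMap : ∀ T → HasInterior T → InteriorOK T → 3 ≤ length (labelsOf T) → IsStasheff (forget (fMap T))
stasheff-fMap T hasInt ok 3≤ with shape T ok
... | branching d c c′ cs          = s≤s (s≤s z≤n) , noBivalent-contract (totalOuts T) T
... | subdivided-branching c c′ cs = s≤s (s≤s z≤n) , noBivalent-contract (totalOuts T) T
... | subdivided-leaf              = contradiction 3≤ λ { (s≤s (s≤s ())) }
... | leaf d                       = contradiction hasInt λ ()

-- A downward root edge has every "out" exterior vertex below it, so it is not on the spine.
essRoot-fMap : ∀ T → InteriorOK T → EssRoot (fMap T)
essRoot-fMap T ok with shape T ok
... | leaf up                      = label-≢⇓ _ ⇑ λ ()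
... | branching up c c′ cs         = label-≢⇓ _ ⇑ λ ()
... | subdivided-leaf              = label-≢⇓ _ ⇕ λ ()
... | subdivided-branching c c′ cs = label-≢⇓ _ ⇕ λ ()
... | leaf down =
  subst (λ b → (if b then just ⇓ else nothing) ≢ just ⇓) (sym (onSpine-self (outsD T))) λ ()
... | branching down c c′ cs =
  subst (λ b → (if b then just ⇓ else nothing) ≢ just ⇓) (sym (onSpine-self (outsD T))) λ ()

1≤totalOuts : ∀ T → InteriorOK T → 1 ≤ totalOuts T
1≤totalOuts (dnode up   _) _  = s≤s z≤n
1≤totalOuts (dnode down cs) ok = down⇒1≤outsD (dnode down cs) ok refl

fMap-IsSE : (α : List Label) → 3 ≤ length α → (T : DTree) → IsAlphaTree α T → IsSE α (fMap T)
fMap-IsSE .(labelsOf T) 3≤ T (hasInt , ok , refl) =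
  stasheff-fMap T hasInt ok 3≤ ,
  cong suc (trans (sLeaves-forget (fMap T)) (eLeaves-contract k T)) ,
  (subst (1 ≤_) (sym (countOut-labelsOf T)) (1≤totalOuts T ok) ,
   subst₂ (λ k′ ls → CompatT k′ (fMap T) ls) (sym (countOut-labelsOf T)) (++-identityʳ (leafLabels T))
     (compat-contract k T [])) ,
  essRoot-fMap T ok ,
  essential-contract k T ok (outsBounded-root T)
  where
  k : ℕ
  k = totalOuts T

eLeaves≡length : ∀ e {n} → nExterior (forget e) ≡ suc n → eLeaves e ≡ n
eLeaves≡length e nExt = trans (sym (sLeaves-forget e)) (suc-injective nExt)

-- The root edge lies on the spine iff the chosen exterior vertex is "out"; otherwise
-- it points toward E, i.e. away from the root exactly when E is nonempty.
rootLabel-place : ∀ m r o ch → m ≢ just ⇓ → 1 ≤ countOut (r ∷ []) + o →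
  isJustB m ≡ onSpine (countOut (r ∷ []) + o) o → rootLabel (dirOf (place m o ch)) ≡ r
rootLabel-place (just ⇑) out o       ch _   _ _     = refl
rootLabel-place (just ⇑) inn o       ch _   _ spine = contradiction (trans spine (onSpine-self o)) λ ()
rootLabel-place (just ⇓) r   o       ch ≢⇓  _ _     = contradiction refl ≢⇓
rootLabel-place (just ⇕) out o       ch _   _ _     = refl
rootLabel-place (just ⇕) inn o       ch _   _ spine = contradiction (trans spine (onSpine-self o)) λ ()
rootLabel-place nothing  out zero    ch _   _ _     = refl
rootLabel-place nothing  out (suc o) ch _   _ spine =
  contradiction (trans spine (onSpine-true {suc (suc o)} {suc o} (s≤s z≤n) ≤-refl)) λ ()
rootLabel-place nothing  inn (suc o) ch _   _ _     = refl

gMap-IsAlphaTree : (α : List Label) (e : ETree) → IsSE α e → IsAlphaTree α (gMap α e)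
gMap-IsAlphaTree []       e (_ , _ , () , _)
gMap-IsAlphaTree (r ∷ ls) (enode m []) ((() , _) , _)
gMap-IsAlphaTree (r ∷ ls) e@(enode m (c ∷ cs)) ((_ , noBiv) , nExt , (1≤k , compat) , ≢⇓ , ess) =
  hasInterior-place m _ _ _ ,
  interiorOK-g k e ls ess compat (countOut-drop≤ 1 (r ∷ ls)) noBiv ,
  cong₂ _∷_ (rootLabel-place m r o (gF (c ∷ cs) ls) ≢⇓ (subst (1 ≤_) k≡ 1≤k)
                (subst (λ k′ → isJustB m ≡ onSpine k′ o) k≡ (proj₁ compat)))
            (trans (leafLabels-g k e ls ess compat (≤-reflexive leaves≡) noBiv) take-all-ls)
  where
  k : ℕ
  k = countOut (r ∷ ls)
  leaves≡ : eLeaves e ≡ length ls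
  leaves≡ = eLeaves≡length e nExt
  take-all-ls : take (eLeaves e) ls ≡ ls
  take-all-ls = take-all (eLeaves e) ls (≤-reflexive (sym leaves≡))
  o : ℕ
  o = countOut (take (eLeaves e) ls)
  k≡ : k ≡ countOut (r ∷ []) + o
  k≡ = trans (countOut-++ (r ∷ []) ls) (cong (λ xs → countOut (r ∷ []) + countOut xs) (sym take-all-ls))

gMap-fMap : (α : List Label) (T : DTree) → IsAlphaTree α T → gMap α (fMap T) ≡ T
gMap-fMap .(labelsOf T) T (_ , ok , refl) =
  trans (cong (gT (fMap T)) (sym (++-identityʳ (leafLabels T))))
        (g-contract (totalOuts T) T [] ok (outsBounded-root T))

fMap-gMap : (α : List Label) (e : ETree) → IsSE α e → fMap (gMap α e) ≡ e
fMap-gMap []         e (_ , _ , () , _)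
fMap-gMap α@(r ∷ ls) e@(enode _ _) se@((_ , noBiv) , nExt , (_ , compat) , _ , ess) =
  trans (cong (λ k → contract k (gT e ls)) totalOuts≡)
        (contract-g (countOut α) e ls ess compat
           (≤-reflexive (eLeaves≡length e nExt)) noBiv)
  where
  totalOuts≡ : totalOuts (gT e ls) ≡ countOut α
  totalOuts≡ = trans (sym (countOut-labelsOf (gT e ls)))
                     (cong countOut (proj₂ (proj₂ (gMap-IsAlphaTree α e se))))

lemma2p5 : (α : List Label) → 3 ≤ length α →
    ((T : DTree) → IsAlphaTree α T → IsSE α (fMap T)) ×
    ((e : ETree) → IsSE α e → IsAlphaTree α (gMap α e)) ×
    ((T : DTree) → IsAlphaTree α T → gMap α (fMap T) ≡ T) ×
    ((e : ETree) → IsSE α e → fMap (gMap α e) ≡ e)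
lemma2p5 α 3≤ = fMap-IsSE α 3≤ , gMap-IsAlphaTree α , gMap-fMap α , fMap-gMap α
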